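{- A finite nonempty set of odd integers is the imbalance set of a tournament if and only if it contains at least one positive and at least one negative integer.
   Context: A tournament is an orientation of a complete simple graph. The imbalance of a vertex $v$ in a digraph is $d^{+}(v)-d^{ - }(v)$ (outdegree minus indegree). The imbalance set of a digraph is the set of imbalances of its vertices. -}

module Defs where

open import Data.Bool using (Bool; true; false; not; if_then_else_)
open import Data.Nat using (ℕ)
open import Data.Fin using (Fin)
open import Data.List using (List; map; allFin)
open import Data.Nat.ListAction using (sum)
open import Data.Integer using (ℤ; +_; _-_; _+_; _*_; _<_; 0ℤ; 1ℤ)
open import Data.Product using (Σ; ∃; _,_)
open import Relation.Binary.PropositionalEquality using (_≡_; _≢_)

record Tournament (n : ℕ) : Set where
  field
    arc        : Fin n → Fin n → Bool
    irrefl     : ∀ i → arc i i ≡ false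
    oneArc     : ∀ i j → i ≢ j → arc j i ≡ not (arc i j)
open Tournament public

indicator : Bool → ℕ
indicator true  = 1
indicator false = 0

outdeg : ∀ {n} → Tournament n → Fin n → ℕ
outdeg {n} T v = sum (map (λ j → indicator (arc T v j)) (allFin n))

indeg : ∀ {n} → Tournament n → Fin n → ℕ
indeg {n} T v = sum (map (λ j → indicator (arc T j v)) (allFin n))

imbalance : ∀ {n} → Tournament n → Fin n → ℤ
imbalance T v = + outdeg T v - + indeg T v

InImbalanceSet : ∀ {n} → Tournament n → ℤ → Set
InImbalanceSet T z = ∃ λ v → imbalance T v ≡ z

Odd : ℤ → Set
Odd z = ∃ λ k → z ≡ 1ℤ + (+ 2) * k

-- The imbalances of a tournament sum to zero (every arc adds 1 to one vertex and
-- subtracts 1 from another), so a tournament with a vertex of nonzero imbalance has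
-- vertices of both signs; odd imbalances are never zero.
--
-- Conversely, let R_k be a regular tournament on 2k+1 vertices. Letting every vertex of
-- R_b beat every vertex of R_a gives a tournament with imbalance set {2a+1, -(2b+1)}.
-- Such blocks can be glued together without changing any imbalance, provided each block
-- carries a 2-colouring with as many vertices of either colour: orient the arcs between
-- two blocks from u to w iff u and w have different colours, so that every vertex gains
-- as many in- as out-arcs. Gluing one block per element of S realises S.
module Submission where

open import Defs
open import Data.Nat using (ℕ; zero; suc; _≤_; z≤n)
import Data.Nat as ℕ
open import Data.Nat.Properties
  using (+-0-commutativeMonoid; +-assoc; +-mono-≤; +-monoʳ-≤; +-cancelʳ-≤; +-cancelˡ-≡; ≤-antisym; *-suc)
  renaming (module ≤-Reasoning to ℕ-≤-Reasoning)
import Data.Nat.ListAction as ListAction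
open import Algebra.Properties.CommutativeMonoid.Sum +-0-commutativeMonoid
  using (sum; sum-syntax; sum-cong-≗; ∑-comm)
open import Data.Integer
  using (ℤ; 0ℤ; 1ℤ; +_; -[1+_]; -_; _-_; _+_; _*_; _<_; _<?_; +<+)
open import Data.Integer.Properties
  using (pos-+; pos-*; +-identityˡ; +-identityʳ; <-cmp; <-irrefl; ≮⇒≥; drop‿+≤+;
         0≤i-j⇒j≤i; i≡j⇒i-j≡0; neg-mono-<; neg-cancel-<)
open import Data.Integer.Tactic.RingSolver using (solve-∀)
open import Data.Bool using (Bool; true; false; not; _xor_)
open import Data.Bool.Properties using (not-involutive; xor-comm)
open import Data.Fin using (Fin; zero; suc; _↑ˡ_; _↑ʳ_; splitAt)
import Data.Fin as Fin
open import Data.Fin.Properties using (any?; splitAt-↑ˡ; splitAt-↑ʳ; splitAt-join; join-splitAt)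
open import Data.Vec.Functional using (_++_)
open import Data.List using (List; []; _∷_; map; allFin; tabulate)
open import Data.List.Properties using (map-tabulate)
open import Data.List.Membership.Propositional using (_∈_; find; lose)
open import Data.List.Relation.Unary.All as All using (All; []; _∷_)
open import Data.List.Relation.Unary.Any using (Any; here)
open import Data.Product using (Σ; Σ-syntax; ∃; _×_; _,_)
open import Data.Sum using (_⊎_; inj₁; inj₂; [_,_])
open import Function using (_∘_; id)
open import Function.Bundles using (_⇔_; mk⇔; Equivalence)
open import Relation.Binary using (tri<; tri≈; tri>)
open import Relation.Binary.PropositionalEquality
  using (_≡_; _≢_; _≗_; refl; sym; trans; cong; cong₂; subst; module ≡-Reasoning)
open import Relation.Nullary using (yes; no; contradiction)

private
  variable
    m n : ℕ

sum-tabulate : (f : Fin n → ℕ) → ListAction.sum (tabulate f) ≡ sum f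
sum-tabulate {zero}  f = refl
sum-tabulate {suc n} f = cong (f zero ℕ.+_) (sum-tabulate (f ∘ suc))

sum-allFin : (f : Fin n → ℕ) → ListAction.sum (map f (allFin n)) ≡ sum f
sum-allFin f = trans (cong ListAction.sum (map-tabulate id f)) (sum-tabulate f)

∑-↑ : ∀ m (f : Fin (m ℕ.+ n) → ℕ) →
      sum f ≡ (∑[ i < m ] f (i ↑ˡ n)) ℕ.+ (∑[ j < n ] f (m ↑ʳ j))
∑-↑ zero    f = refl
∑-↑ (suc m) f = trans (cong (f zero ℕ.+_) (∑-↑ m (f ∘ suc))) (sym (+-assoc (f zero) _ _))

∑-splitAt : ∀ m (g : Fin m ⊎ Fin n → ℕ) →
            sum (g ∘ splitAt m) ≡ sum (g ∘ inj₁) ℕ.+ sum (g ∘ inj₂)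
∑-splitAt {n} m g = trans (∑-↑ m (g ∘ splitAt m))
  (cong₂ ℕ._+_ (sum-cong-≗ (λ i → cong g (splitAt-↑ˡ m i n)))
               (sum-cong-≗ (λ j → cong g (splitAt-↑ʳ m n j))))

∑-mono-≤ : {f g : Fin n → ℕ} → (∀ i → f i ≤ g i) → sum f ≤ sum g
∑-mono-≤ {zero}  _   = z≤n
∑-mono-≤ {suc n} f≤g = +-mono-≤ (f≤g zero) (∑-mono-≤ (f≤g ∘ suc))

pointwise-≤∧∑-≡⇒≗ : {f g : Fin n → ℕ} → (∀ i → f i ≤ g i) → sum f ≡ sum g → f ≗ g
pointwise-≤∧∑-≡⇒≗ {suc n} {f} {g} f≤g ∑f≡∑g = λ
  { zero    → head≡
  ; (suc i) → pointwise-≤∧∑-≡⇒≗ (f≤g ∘ suc) tail≡ i }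
  where
  open ℕ-≤-Reasoning
  head≡ : f zero ≡ g zero
  head≡ = ≤-antisym (f≤g zero) (+-cancelʳ-≤ (sum (f ∘ suc)) (g zero) (f zero) (begin
    g zero ℕ.+ sum (f ∘ suc) ≤⟨ +-monoʳ-≤ (g zero) (∑-mono-≤ (f≤g ∘ suc)) ⟩
    g zero ℕ.+ sum (g ∘ suc) ≡⟨ sym ∑f≡∑g ⟩
    f zero ℕ.+ sum (f ∘ suc) ∎))
  tail≡ : sum (f ∘ suc) ≡ sum (g ∘ suc)
  tail≡ = +-cancelˡ-≡ (f zero) _ _ (trans ∑f≡∑g (cong (ℕ._+ sum (g ∘ suc)) (sym head≡)))

count : (Fin n → Bool) → ℕ
count {n} f = ∑[ i < n ] indicator (f i)

splitAt-cases : ∀ m (P : Fin (m ℕ.+ n) → Set) → (∀ i → P (i ↑ˡ n)) → (∀ j → P (m ↑ʳ j)) → ∀ v → P v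
splitAt-cases {n} m P P↑ˡ P↑ʳ v =
  subst P (join-splitAt m n v) ([_,_] {C = P ∘ Fin.join m n} P↑ˡ P↑ʳ (splitAt m v))

+[a+b]-+[c+d] : ∀ a b c d → + (a ℕ.+ b) - + (c ℕ.+ d) ≡ (+ a - + c) + (+ b - + d)
+[a+b]-+[c+d] a b c d =
  trans (cong₂ _-_ (pos-+ a b) (pos-+ c d)) (interchange (+ a) (+ b) (+ c) (+ d))
  where
  interchange : ∀ w x y z → (w + x) - (y + z) ≡ (w - y) + (x - z)
  interchange = solve-∀

i-j≡-[j-i] : ∀ i j → i - j ≡ - (j - i)
i-j≡-[j-i] = solve-∀

outdeg≡count : (T : Tournament n) (v : Fin n) → outdeg T v ≡ count (arc T v)
outdeg≡count T v = sum-allFin (indicator ∘ arc T v)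

indeg≡count : (T : Tournament n) (v : Fin n) → indeg T v ≡ count (λ u → arc T u v)
indeg≡count T v = sum-allFin (λ u → indicator (arc T u v))

imbalance≡count : (T : Tournament n) (v : Fin n) →
                  imbalance T v ≡ + count (arc T v) - + count (λ u → arc T u v)
imbalance≡count T v = cong₂ (λ p q → + p - + q) (outdeg≡count T v) (indeg≡count T v)

handshake : (T : Tournament n) → ∑[ v < n ] outdeg T v ≡ ∑[ v < n ] indeg T v
handshake T = begin
  sum (outdeg T)                                  ≡⟨ sum-cong-≗ (outdeg≡count T) ⟩
  sum (λ v → sum (λ j → indicator (arc T v j)))   ≡⟨ ∑-comm (λ v j → indicator (arc T v j)) ⟩
  sum (λ j → sum (λ v → indicator (arc T v j)))   ≡⟨ sum-cong-≗ (indeg≡count T) ⟨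
  sum (indeg T)                                   ∎
  where open ≡-Reasoning

reverse : Tournament n → Tournament n
reverse T = record
  { arc    = λ i j → arc T j i
  ; irrefl = irrefl T
  ; oneArc = λ i j i≢j → oneArc T j i (i≢j ∘ sym)
  }

imbalance-reverse : (T : Tournament n) (v : Fin n) → imbalance (reverse T) v ≡ - imbalance T v
imbalance-reverse T v = i-j≡-[j-i] (+ indeg T v) (+ outdeg T v)

∃-negative-imbalance : (T : Tournament n) {v : Fin n} →
                       0ℤ < imbalance T v → ∃ λ u → imbalance T u < 0ℤ
∃-negative-imbalance T {v} 0<imb with any? (λ u → imbalance T u <? 0ℤ)
... | yes negative = negative
... | no ∄negative = contradiction (sym (imbalance≡0 v)) (λ eq → <-irrefl eq 0<imb)
  where
  indeg≤outdeg : ∀ u → indeg T u ≤ outdeg T u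
  indeg≤outdeg u = drop‿+≤+ (0≤i-j⇒j≤i (≮⇒≥ (∄negative ∘ (u ,_))))
  imbalance≡0 : ∀ u → imbalance T u ≡ 0ℤ
  imbalance≡0 u = i≡j⇒i-j≡0 (cong +_ (sym (pointwise-≤∧∑-≡⇒≗ indeg≤outdeg (sym (handshake T)) u)))

∃-positive-imbalance : (T : Tournament n) {v : Fin n} →
                       imbalance T v < 0ℤ → ∃ λ u → 0ℤ < imbalance T u
∃-positive-imbalance T {v} imb<0 =
  let u , imb′<0 = ∃-negative-imbalance (reverse T) 0<imb′ in
  u , neg-cancel-< (subst (_< 0ℤ) (imbalance-reverse T u) imb′<0)
  where
  0<imb′ : 0ℤ < imbalance (reverse T) v
  0<imb′ = subst (0ℤ <_) (sym (imbalance-reverse T v)) (neg-mono-< imb<0)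

imbalances-of-both-signs : (T : Tournament n) {v : Fin n} → imbalance T v ≢ 0ℤ →
                           (∃ λ u → 0ℤ < imbalance T u) × (∃ λ u → imbalance T u < 0ℤ)
imbalances-of-both-signs T {v} imb≢0 with <-cmp (imbalance T v) 0ℤ
... | tri< imb<0 _ _ = ∃-positive-imbalance T imb<0 , v , imb<0
... | tri≈ _ imb≡0 _ = contradiction imb≡0 imb≢0
... | tri> _ _ 0<imb = (v , 0<imb) , ∃-negative-imbalance T 0<imb

double : ℕ → ℕ
double zero    = zero
double (suc k) = suc (suc (double k))

odd : ℕ → ℕ
odd k = suc (double k)

double≡2* : ∀ k → double k ≡ 2 ℕ.* k
double≡2* zero    = refl
double≡2* (suc k) = trans (cong (λ n → suc (suc n)) (double≡2* k)) (sym (*-suc 2 k))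

+odd≡1+2* : ∀ k → + odd k ≡ 1ℤ + + 2 * + k
+odd≡1+2* k = cong (_+_ 1ℤ) (trans (cong +_ (double≡2* k)) (pos-* 2 k))

Odd⇒±odd : ∀ {z} → Odd z → (∃ λ a → z ≡ + odd a) ⊎ (∃ λ b → z ≡ - + odd b)
Odd⇒±odd (+ a      , z≡) = inj₁ (a , trans z≡ (sym (+odd≡1+2* a)))
Odd⇒±odd (-[1+ b ] , z≡) = inj₂ (b , trans z≡ (trans (negate (+ b)) (cong -_ (sym (+odd≡1+2* b)))))
  where
  negate : ∀ x → 1ℤ + + 2 * - (1ℤ + x) ≡ - (1ℤ + + 2 * x)
  negate = solve-∀

Odd⇒≢0 : ∀ {z} → Odd z → z ≢ 0ℤ
Odd⇒≢0 odd-z with Odd⇒±odd odd-z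
... | inj₁ (_ , refl) = λ ()
... | inj₂ (_ , refl) = λ ()

Odd∧positive : ∀ {z} → Odd z → 0ℤ < z → ∃ λ a → z ≡ + odd a
Odd∧positive odd-z 0<z with Odd⇒±odd odd-z
... | inj₁ z≡+odd = z≡+odd
... | inj₂ (_ , refl) with 0<z
...   | ()

Odd∧negative : ∀ {z} → Odd z → z < 0ℤ → ∃ λ b → z ≡ - + odd b
Odd∧negative odd-z z<0 with Odd⇒±odd odd-z
... | inj₂ z≡-odd = z≡-odd
... | inj₁ (_ , refl) with z<0
...   | +<+ ()

-- Two-colourings

surplus : (Fin n → Bool) → ℤ
surplus f = + count f - + count (not ∘ f)

Balanced : (Fin n → Bool) → Set
Balanced f = surplus f ≡ 0ℤ

surplus-cong : {f g : Fin n → Bool} → f ≗ g → surplus f ≡ surplus g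
surplus-cong f≗g = cong₂ (λ p q → + p - + q)
  (sum-cong-≗ (cong indicator ∘ f≗g)) (sum-cong-≗ (cong (indicator ∘ not) ∘ f≗g))

surplus-suc : (f : Fin (suc n) → Bool) →
              surplus f ≡ (+ indicator (f zero) - + indicator (not (f zero))) + surplus (f ∘ suc)
surplus-suc f = +[a+b]-+[c+d]
  (indicator (f zero)) (count (f ∘ suc)) (indicator (not (f zero))) (count (not ∘ f ∘ suc))

surplus-not : (f : Fin n → Bool) → surplus (not ∘ f) ≡ - surplus f
surplus-not f = trans
  (cong (λ c → + count (not ∘ f) - + c) (sum-cong-≗ (cong indicator ∘ not-involutive ∘ f)))
  (i-j≡-[j-i] (+ count (not ∘ f)) (+ count f))

surplus-++ : (f : Fin m → Bool) (g : Fin n → Bool) → surplus (f ++ g) ≡ surplus f + surplus g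
surplus-++ {m} f g = trans
  (cong₂ (λ p q → + p - + q) (∑-splitAt m (indicator ∘ [ f , g ]))
                             (∑-splitAt m (indicator ∘ not ∘ [ f , g ])))
  (+[a+b]-+[c+d] (count f) (count g) (count (not ∘ f)) (count (not ∘ g)))

surplus-true : ∀ n → surplus {n} (λ _ → true) ≡ + n
surplus-true zero    = refl
surplus-true (suc n) = trans (surplus-suc {n} (λ _ → true)) (cong (_+_ 1ℤ) (surplus-true n))

Balanced-xor : ∀ b {f : Fin n → Bool} → Balanced f → Balanced (λ i → b xor f i)
Balanced-xor false balanced = balanced
Balanced-xor true  {f} balanced = trans (surplus-not f) (cong -_ balanced)

isEven : Fin n → Bool
isEven zero    = true
isEven (suc i) = not (isEven i)

surplus-isEven-suc : ∀ n → surplus (isEven {suc n}) ≡ 1ℤ - surplus (isEven {n})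
surplus-isEven-suc n = trans (surplus-suc (isEven {suc n})) (cong (_+_ 1ℤ) (surplus-not (isEven {n})))

surplus-isEven : ∀ k → surplus (isEven {odd k}) ≡ 1ℤ
surplus-isEven zero    = refl
surplus-isEven (suc k) = begin
  surplus (isEven {odd (suc k)})        ≡⟨ surplus-isEven-suc (suc (odd k)) ⟩
  1ℤ - surplus (isEven {suc (odd k)})   ≡⟨ cong (_-_ 1ℤ) (surplus-isEven-suc (odd k)) ⟩
  1ℤ - (1ℤ - surplus (isEven {odd k}))  ≡⟨ cong (λ s → 1ℤ - (1ℤ - s)) (surplus-isEven k) ⟩
  1ℤ                                    ∎
  where open ≡-Reasoning

-- Gluing tournaments

module _ (T₁ : Tournament m) (T₂ : Tournament n) (c : Fin m → Fin n → Bool) where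

  private
    arc⊎ : Fin m ⊎ Fin n → Fin m ⊎ Fin n → Bool
    arc⊎ (inj₁ i) (inj₁ i′) = arc T₁ i i′
    arc⊎ (inj₁ i) (inj₂ j)  = c i j
    arc⊎ (inj₂ j) (inj₁ i)  = not (c i j)
    arc⊎ (inj₂ j) (inj₂ j′) = arc T₂ j j′

    irrefl⊎ : ∀ x → arc⊎ x x ≡ false
    irrefl⊎ (inj₁ i) = irrefl T₁ i
    irrefl⊎ (inj₂ j) = irrefl T₂ j

    oneArc⊎ : ∀ x y → x ≢ y → arc⊎ y x ≡ not (arc⊎ x y)
    oneArc⊎ (inj₁ i) (inj₁ i′) x≢y = oneArc T₁ i i′ (x≢y ∘ cong inj₁)
    oneArc⊎ (inj₁ i) (inj₂ j)  _   = refl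
    oneArc⊎ (inj₂ j) (inj₁ i)  _   = sym (not-involutive (c i j))
    oneArc⊎ (inj₂ j) (inj₂ j′) x≢y = oneArc T₂ j j′ (x≢y ∘ cong inj₂)

    splitAt-injective : ∀ {u v} → splitAt m u ≡ splitAt m v → u ≡ v
    splitAt-injective {u} {v} eq =
      trans (sym (join-splitAt m n u)) (trans (cong (Fin.join m n) eq) (join-splitAt m n v))

  joinWith : Tournament (m ℕ.+ n)
  joinWith = record
    { arc    = λ u v → arc⊎ (splitAt m u) (splitAt m v)
    ; irrefl = λ u → irrefl⊎ (splitAt m u)
    ; oneArc = λ u v u≢v → oneArc⊎ (splitAt m u) (splitAt m v) (u≢v ∘ splitAt-injective)
    }

  private
    outdeg-joinWith : ∀ x → outdeg joinWith (Fin.join m n x) ≡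
                            count (arc⊎ x ∘ inj₁) ℕ.+ count (arc⊎ x ∘ inj₂)
    outdeg-joinWith x = begin
      outdeg joinWith (Fin.join m n x)
        ≡⟨ outdeg≡count joinWith _ ⟩
      count (λ v → arc⊎ (splitAt m (Fin.join m n x)) (splitAt m v))
        ≡⟨ cong (λ y → count (λ v → arc⊎ y (splitAt m v))) (splitAt-join m n x) ⟩
      count (λ v → arc⊎ x (splitAt m v))
        ≡⟨ ∑-splitAt m (indicator ∘ arc⊎ x) ⟩
      count (arc⊎ x ∘ inj₁) ℕ.+ count (arc⊎ x ∘ inj₂)
        ∎
      where open ≡-Reasoning

    indeg-joinWith : ∀ x → indeg joinWith (Fin.join m n x) ≡
                           count (λ i → arc⊎ (inj₁ i) x) ℕ.+ count (λ j → arc⊎ (inj₂ j) x)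
    indeg-joinWith x = begin
      indeg joinWith (Fin.join m n x)
        ≡⟨ indeg≡count joinWith _ ⟩
      count (λ v → arc⊎ (splitAt m v) (splitAt m (Fin.join m n x)))
        ≡⟨ cong (λ y → count (λ v → arc⊎ (splitAt m v) y)) (splitAt-join m n x) ⟩
      count (λ v → arc⊎ (splitAt m v) x)
        ≡⟨ ∑-splitAt m (λ y → indicator (arc⊎ y x)) ⟩
      count (λ i → arc⊎ (inj₁ i) x) ℕ.+ count (λ j → arc⊎ (inj₂ j) x)
        ∎
      where open ≡-Reasoning

  imbalance-joinWith-↑ˡ : ∀ i → imbalance joinWith (i ↑ˡ n) ≡ imbalance T₁ i + surplus (c i)
  imbalance-joinWith-↑ˡ i = begin
    imbalance joinWith (i ↑ˡ n)
      ≡⟨ cong₂ (λ p q → + p - + q) (outdeg-joinWith (inj₁ i)) (indeg-joinWith (inj₁ i)) ⟩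
    + (count (arc T₁ i) ℕ.+ count (c i)) - + (count (λ i′ → arc T₁ i′ i) ℕ.+ count (not ∘ c i))
      ≡⟨ +[a+b]-+[c+d] (count (arc T₁ i)) (count (c i)) (count (λ i′ → arc T₁ i′ i)) (count (not ∘ c i)) ⟩
    (+ count (arc T₁ i) - + count (λ i′ → arc T₁ i′ i)) + surplus (c i)
      ≡⟨ cong (_+ surplus (c i)) (imbalance≡count T₁ i) ⟨
    imbalance T₁ i + surplus (c i)
      ∎
    where open ≡-Reasoning

  imbalance-joinWith-↑ʳ : ∀ j → imbalance joinWith (m ↑ʳ j) ≡ - surplus (λ i → c i j) + imbalance T₂ j
  imbalance-joinWith-↑ʳ j = begin
    imbalance joinWith (m ↑ʳ j)
      ≡⟨ cong₂ (λ p q → + p - + q) (outdeg-joinWith (inj₂ j)) (indeg-joinWith (inj₂ j)) ⟩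
    + (count (λ i → not (c i j)) ℕ.+ count (arc T₂ j)) - + (count (λ i → c i j) ℕ.+ count (λ j′ → arc T₂ j′ j))
      ≡⟨ +[a+b]-+[c+d] (count (λ i → not (c i j))) (count (arc T₂ j)) (count (λ i → c i j)) (count (λ j′ → arc T₂ j′ j)) ⟩
    (+ count (λ i → not (c i j)) - + count (λ i → c i j)) + (+ count (arc T₂ j) - + count (λ j′ → arc T₂ j′ j))
      ≡⟨ cong₂ _+_ (i-j≡-[j-i] (+ count (λ i → not (c i j))) (+ count (λ i → c i j)))
                   (sym (imbalance≡count T₂ j)) ⟩
    - surplus (λ i → c i j) + imbalance T₂ j
      ∎
    where open ≡-Reasoning

singleton : Tournament 1
singleton = record
  { arc    = λ _ _ → false
  ; irrefl = λ _ → refl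
  ; oneArc = λ { zero zero 0≢0 → contradiction refl 0≢0 }
  }

arrow : Tournament 2
arrow = record { arc = arc₂ ; irrefl = irrefl₂ ; oneArc = oneArc₂ }
  where
  arc₂ : Fin 2 → Fin 2 → Bool
  arc₂ zero (suc zero) = true
  arc₂ _    _          = false
  irrefl₂ : ∀ i → arc₂ i i ≡ false
  irrefl₂ zero       = refl
  irrefl₂ (suc zero) = refl
  oneArc₂ : ∀ i j → i ≢ j → arc₂ j i ≡ not (arc₂ i j)
  oneArc₂ zero       zero       i≢j = contradiction refl i≢j
  oneArc₂ zero       (suc zero) _   = refl
  oneArc₂ (suc zero) zero       _   = refl
  oneArc₂ (suc zero) (suc zero) i≢j = contradiction refl i≢j

-- An odd number of indices has one even index more, which cancels the imbalances ±1 of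
-- the arrow; each old vertex wins exactly one of its two new arcs.
parityArcs : Fin 2 → Fin n → Bool
parityArcs zero       j = not (isEven j)
parityArcs (suc zero) j = isEven j

parityArcs-balanced : (j : Fin n) → Balanced (λ i → parityArcs i j)
parityArcs-balanced j with isEven j
... | true  = refl
... | false = refl

regular : ∀ k → Tournament (odd k)
regular zero    = singleton
regular (suc k) = joinWith arrow (regular k) parityArcs

regular-imbalance : ∀ k v → imbalance (regular k) v ≡ 0ℤ
regular-imbalance zero    zero = refl
regular-imbalance (suc k) = splitAt-cases 2 (λ v → imbalance (regular (suc k)) v ≡ 0ℤ) arrow-end old
  where
  arrow-end : ∀ i → imbalance (regular (suc k)) (i ↑ˡ odd k) ≡ 0ℤ
  arrow-end zero       = trans (imbalance-joinWith-↑ˡ arrow (regular k) parityArcs zero)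
    (cong (_+_ 1ℤ) (trans (surplus-not (isEven {odd k})) (cong -_ (surplus-isEven k))))
  arrow-end (suc zero) = trans (imbalance-joinWith-↑ˡ arrow (regular k) parityArcs (suc zero))
    (cong (_+_ (- 1ℤ)) (surplus-isEven k))
  old : ∀ j → imbalance (regular (suc k)) (2 ↑ʳ j) ≡ 0ℤ
  old j = trans (imbalance-joinWith-↑ʳ arrow (regular k) parityArcs j)
    (cong₂ (λ s t → - s + t) (parityArcs-balanced j) (regular-imbalance k j))

record BalancedTournament : Set where
  field
    order      : ℕ
    tournament : Tournament order
    colour     : Fin order → Bool
    balanced   : Balanced colour
open BalancedTournament

ImbalancesIn : Tournament n → (ℤ → Set) → Set
ImbalancesIn T P = ∀ {z} → InImbalanceSet T z → P z

∅ : BalancedTournament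
∅ = record
  { order      = 0
  ; tournament = record { arc = λ () ; irrefl = λ () ; oneArc = λ () }
  ; colour     = λ ()
  ; balanced   = refl
  }

_⊕_ : BalancedTournament → BalancedTournament → BalancedTournament
G ⊕ H = record
  { order      = order G ℕ.+ order H
  ; tournament = joinWith (tournament G) (tournament H) (λ i j → colour G i xor colour H j)
  ; colour     = colour G ++ colour H
  ; balanced   = trans (surplus-++ (colour G) (colour H)) (cong₂ _+_ (balanced G) (balanced H))
  }

module _ (G H : BalancedTournament) where

  private
    arcs : Fin (order G) → Fin (order H) → Bool
    arcs i j = colour G i xor colour H j

  imbalance-⊕-↑ˡ : ∀ i → imbalance (tournament (G ⊕ H)) (i ↑ˡ order H) ≡ imbalance (tournament G) i
  imbalance-⊕-↑ˡ i = trans (imbalance-joinWith-↑ˡ (tournament G) (tournament H) arcs i)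
    (trans (cong (_+_ (imbalance (tournament G) i)) balanced-row)
           (+-identityʳ (imbalance (tournament G) i)))
    where
    balanced-row : Balanced (λ j → colour G i xor colour H j)
    balanced-row = Balanced-xor (colour G i) {colour H} (balanced H)

  imbalance-⊕-↑ʳ : ∀ j → imbalance (tournament (G ⊕ H)) (order G ↑ʳ j) ≡ imbalance (tournament H) j
  imbalance-⊕-↑ʳ j = trans (imbalance-joinWith-↑ʳ (tournament G) (tournament H) arcs j)
    (trans (cong (λ s → - s + imbalance (tournament H) j) balanced-column)
           (+-identityˡ (imbalance (tournament H) j)))
    where
    balanced-column : Balanced (λ i → colour G i xor colour H j)
    balanced-column = trans (surplus-cong (λ i → xor-comm (colour G i) (colour H j)))
                            (Balanced-xor (colour H j) {colour G} (balanced G))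

  InImbalanceSet-⊕ˡ : ∀ {z} → InImbalanceSet (tournament G) z → InImbalanceSet (tournament (G ⊕ H)) z
  InImbalanceSet-⊕ˡ (i , e) = i ↑ˡ order H , trans (imbalance-⊕-↑ˡ i) e

  InImbalanceSet-⊕ʳ : ∀ {z} → InImbalanceSet (tournament H) z → InImbalanceSet (tournament (G ⊕ H)) z
  InImbalanceSet-⊕ʳ (j , e) = order G ↑ʳ j , trans (imbalance-⊕-↑ʳ j) e

  InImbalanceSet-⊕⁻ : ∀ {z} → InImbalanceSet (tournament (G ⊕ H)) z →
                      InImbalanceSet (tournament G) z ⊎ InImbalanceSet (tournament H) z
  InImbalanceSet-⊕⁻ (v , refl) = splitAt-cases (order G)
    (λ v → InImbalanceSet (tournament G) (imbalance (tournament (G ⊕ H)) v) ⊎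
           InImbalanceSet (tournament H) (imbalance (tournament (G ⊕ H)) v))
    (λ i → inj₁ (i , sym (imbalance-⊕-↑ˡ i)))
    (λ j → inj₂ (j , sym (imbalance-⊕-↑ʳ j)))
    v

cover : (P : ℤ → Set) {L : List ℤ} →
        All (λ z → Σ[ G ∈ BalancedTournament ]
                     InImbalanceSet (tournament G) z × ImbalancesIn (tournament G) P) L →
        Σ[ G ∈ BalancedTournament ]
          All (InImbalanceSet (tournament G)) L × ImbalancesIn (tournament G) P
cover P []                             = ∅ , [] , λ { (() , _) }
cover P ((G , z∈G , G⊆P) ∷ realisations) =
  let H , L⊆H , H⊆P = cover P realisations in
  G ⊕ H ,
  InImbalanceSet-⊕ˡ G H z∈G ∷ All.map (InImbalanceSet-⊕ʳ G H) L⊆H ,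
  λ w∈G⊕H → [ G⊆P , H⊆P ] (InImbalanceSet-⊕⁻ G H w∈G⊕H)

-- Realising a set of odd integers

dominating : ℕ → ℕ → BalancedTournament
dominating m n = record
  { order      = odd m ℕ.+ odd n
  ; tournament = joinWith (regular m) (regular n) (λ _ _ → true)
  ; colour     = isEven {odd m} ++ (not ∘ isEven {odd n})
  ; balanced   = trans (surplus-++ (isEven {odd m}) (not ∘ isEven {odd n}))
      (cong₂ _+_ (surplus-isEven m) (trans (surplus-not (isEven {odd n})) (cong -_ (surplus-isEven n))))
  }

module _ (m n : ℕ) where

  private
    T : Tournament (odd m ℕ.+ odd n)
    T = tournament (dominating m n)

  dominating-imbalance-↑ˡ : ∀ i → imbalance T (i ↑ˡ odd n) ≡ + odd n
  dominating-imbalance-↑ˡ i = trans (imbalance-joinWith-↑ˡ (regular m) (regular n) (λ _ _ → true) i)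
    (trans (cong₂ _+_ (regular-imbalance m i) (surplus-true (odd n))) (+-identityˡ (+ odd n)))

  dominating-imbalance-↑ʳ : ∀ j → imbalance T (odd m ↑ʳ j) ≡ - + odd m
  dominating-imbalance-↑ʳ j = trans (imbalance-joinWith-↑ʳ (regular m) (regular n) (λ _ _ → true) j)
    (trans (cong₂ (λ s t → - s + t) (surplus-true (odd m)) (regular-imbalance n j))
           (+-identityʳ (- + odd m)))

  dominating-imbalancesIn : {P : ℤ → Set} → P (+ odd n) → P (- + odd m) → ImbalancesIn T P
  dominating-imbalancesIn {P} P⁺ P⁻ (v , refl) = splitAt-cases (odd m) (P ∘ imbalance T)
    (λ i → subst P (sym (dominating-imbalance-↑ˡ i)) P⁺)
    (λ j → subst P (sym (dominating-imbalance-↑ʳ j)) P⁻)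
    v

realise : ∀ {S} → All Odd S → Any (0ℤ <_) S → Any (_< 0ℤ) S →
          Σ[ G ∈ BalancedTournament ]
            All (InImbalanceSet (tournament G)) S × ImbalancesIn (tournament G) (_∈ S)
realise {S} odd-S positive negative with find positive | find negative
... | _ , z⁺∈S , 0<z⁺ | _ , z⁻∈S , z⁻<0
  with Odd∧positive (All.lookup odd-S z⁺∈S) 0<z⁺ | Odd∧negative (All.lookup odd-S z⁻∈S) z⁻<0
... | a , refl | b , refl = cover (_∈ S) (All.tabulate block)
  where
  block : ∀ {z} → z ∈ S → Σ[ G ∈ BalancedTournament ]
                            InImbalanceSet (tournament G) z × ImbalancesIn (tournament G) (_∈ S)
  block z∈S with Odd⇒±odd (All.lookup odd-S z∈S)
  ... | inj₁ (a′ , refl) = dominating b a′ ,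
    (zero ↑ˡ odd a′ , dominating-imbalance-↑ˡ b a′ zero) , dominating-imbalancesIn b a′ {_∈ S} z∈S z⁻∈S
  ... | inj₂ (b′ , refl) = dominating b′ a ,
    (odd b′ ↑ʳ zero , dominating-imbalance-↑ʳ b′ a zero) , dominating-imbalancesIn b′ a {_∈ S} z⁺∈S z∈S

theorem2p4 : (S : List ℤ) → S ≢ [] → All Odd S →
    ((Σ ℕ λ n → Σ (Tournament n) λ T → ∀ z → (z ∈ S ⇔ InImbalanceSet T z))
      ⇔ (Any (λ z → 0ℤ < z) S × Any (λ z → z < 0ℤ) S))
theorem2p4 []      []≢[] _     = contradiction refl []≢[]
theorem2p4 (z ∷ S) _     odd-S = mk⇔ both-signs realisation
  where
  both-signs : (Σ ℕ λ n → Σ (Tournament n) λ T → ∀ w → (w ∈ z ∷ S ⇔ InImbalanceSet T w)) →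
               Any (0ℤ <_) (z ∷ S) × Any (_< 0ℤ) (z ∷ S)
  both-signs (_ , T , S⇔imb) =
    let v , imb≡z = Equivalence.to (S⇔imb z) (here refl)
        (u⁺ , 0<imb) , (u⁻ , imb<0) =
          imbalances-of-both-signs T (Odd⇒≢0 (All.head odd-S) ∘ trans (sym imb≡z))
    in lose (Equivalence.from (S⇔imb _) (u⁺ , refl)) 0<imb ,
       lose (Equivalence.from (S⇔imb _) (u⁻ , refl)) imb<0

  realisation : Any (0ℤ <_) (z ∷ S) × Any (_< 0ℤ) (z ∷ S) →
                Σ ℕ λ n → Σ (Tournament n) λ T → ∀ w → (w ∈ z ∷ S ⇔ InImbalanceSet T w)
  realisation (positive , negative) =
    let G , S⊆G , G⊆S = realise odd-S positive negative
    in order G , tournament G , λ w → mk⇔ (All.lookup S⊆G) G⊆S
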